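{- Let $\beta \geq 2$ be a fixed integer. For the minimum problem under uncertainty (even when the family consists of a single set), for the sorting problem under uncertainty, and for the MST problem under uncertainty, there is no deterministic $\beta$-robust algorithm that is $\alpha$-consistent for any $\alpha < 1 + \frac{1}{\beta}$. Conversely, for any $\alpha>1$, no deterministic $\alpha$-consistent algorithm is $\beta$-robust for any $\beta < \max\{\frac{1}{\alpha-1},2\}$.
   Context: Uncertainty intervals: each uncertain element $i$ has an interval $I_i$ that is either open, $I_i=(L_i,U_i)$, or trivial, $I_i=\{w_i\}$; it has an unknown true value $w_i\in I_i$ and a given predicted value $\bar w_i\in I_i$. A query of $I_i$ reveals $w_i$. Minimum problem: given intervals $\mathcal{I}=\{I_1,\dots,I_n\}$ and a family $\mathcal{S}$ of subsets of $\mathcal{I}$, determine for each $S\in\mathcal{S}$ an element of $S$ with minimum true value. Sorting problem: same input; determine for each $S\in\mathcal{S}$ the order of its elements by true value. MST problem: given a graph $G=(V,E)$ with an uncertainty interval (and prediction) for each edge weight, determine a spanning tree that is a minimum spanning tree for the true weights. A query set $Q$ is feasible if, knowing the true values of the elements in $Q$ (and the intervals of the others), the required answer is the same for every assignment of values in the intervals that agrees with the true values on $Q$. $\mathrm{opt}$ denotes the minimum size of a feasible query set for the true values. An algorithm knows the intervals and predictions (not the true values), queries elements adaptively one by one, and stops when its queries form a feasible set; $|\mathrm{ALG}|$ is its number of queries. It is $\rho$-competitive if $|\mathrm{ALG}|\le\rho\cdot\mathrm{opt}$ on every instance; $\alpha$-consistent if it is $\alpha$-competitive on all instances whose predictions are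 all correct ($\bar w_i=w_i$ for all $i$); $\beta$-robust if it is $\beta$-competitive on all instances regardless of the predictions.
   Formalization: The interval endpoints, true values and predicted values, as well as the ratios α and β (apart from the integer β of the first claim), are taken in the rationals. -}

module Defs where

open import Data.Nat as ℕ using (ℕ; zero; suc)
open import Data.Integer using (+_)
open import Data.Rational as ℚ using (ℚ; 0ℚ; 1ℚ; _/_; _-_; -_; _*_; 1/_; _⊔_; Positive; positive)
open import Data.Rational.Properties using (pos⇒nonZero; +-monoˡ-<; +-inverseʳ)
open import Data.Fin using (Fin)
open import Data.Fin.Subset using (Subset; ∣_∣; Nonempty) renaming (_∈_ to _∈ₛ_)
open import Data.List using (List; []; _∷_; map; length; foldr; allFin)
open import Data.List.Membership.Propositional using () renaming (_∈_ to _∈ₗ_)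
open import Data.List.Relation.Unary.Unique.Propositional using (Unique)
open import Data.List.Relation.Unary.Linked using (Linked)
open import Data.Maybe using (Maybe; nothing; just)
open import Data.Product using (Σ; ∃; _×_; _,_; proj₁; proj₂)
open import Data.Sum using (_⊎_)
open import Data.Bool using (if_then_else_)
open import Data.Unit using (⊤)
open import Data.Vec using (lookup)
open import Function.Bundles using (_⇔_)
open import Relation.Binary.PropositionalEquality using (_≡_; subst)
open import Relation.Nullary using (¬_)

⟦_⟧ : ℕ → ℚ
⟦ k ⟧ = (+ k) / 1

-- 1 / β for an integer β = 2 + b ≥ 2
inv2+ : ℕ → ℚ
inv2+ b = (+ 1) / (2 ℕ.+ b)

1<⇒0<-1 : ∀ α → 1ℚ ℚ.< α → 0ℚ ℚ.< α - 1ℚ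
1<⇒0<-1 α h = subst (ℚ._< α - 1ℚ) (+-inverseʳ 1ℚ) (+-monoˡ-< (- 1ℚ) h)

invMinus1 : (α : ℚ) → 1ℚ ℚ.< α → ℚ
invMinus1 α h = (1/ (α - 1ℚ)) {{pos⇒nonZero (α - 1ℚ) {{positive (1<⇒0<-1 α h)}}}}

data Interval : Set where
  open⟨_,_⟩ : (L U : ℚ) → L ℚ.< U → Interval
  trivial   : ℚ → Interval

_∈I_ : ℚ → Interval → Set
x ∈I open⟨ L , U ⟩ _ = (L ℚ.< x) × (x ℚ.< U)
x ∈I trivial w        = x ≡ w

-- A problem under uncertainty over n uncertain elements Fin n:
--   Str n      : the combinatorial part of the input (set family, graph, ...)
--   WellPosed  : standing requirement on inputs (answer always exists)
--   Ans s      : possible answers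
--   Correct s a w : a is a correct answer for values w

record Problem : Set₁ where
  field
    Str       : ℕ → Set
    WellPosed : ∀ {n} → Str n → Set
    Ans       : ∀ {n} → Str n → Set
    Correct   : ∀ {n} (s : Str n) → Ans s → (Fin n → ℚ) → Set

module _ (P : Problem) where
  open Problem P

  Feasible : ∀ {n} → Str n → (Fin n → Interval) → (Fin n → ℚ) → (Fin n → Set) → Set
  Feasible {n} s I w Q =
    Σ (Ans s) λ a → (w' : Fin n → ℚ) → (∀ i → w' i ∈I I i) → (∀ i → Q i → w' i ≡ w i) →
      Correct s a w'

  IsOpt : ∀ {n} → Str n → (Fin n → Interval) → (Fin n → ℚ) → ℕ → Set
  IsOpt {n} s I w k =
    Σ (Subset n) (λ Q → (∣ Q ∣ ≡ k) × Feasible s I w (_∈ₛ Q)) ×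
    ((Q : Subset n) → Feasible s I w (_∈ₛ Q) → k ℕ.≤ ∣ Q ∣)

  -- A deterministic algorithm: knows the combinatorial input, the intervals and the
  -- predictions, and the (element, revealed value) pairs of its queries so far; it
  -- returns the next element to query (nothing = it makes no further query).
  Algorithm : Set
  Algorithm = ∀ {n} → Str n → (Fin n → Interval) → (Fin n → ℚ) →
              List (Fin n × ℚ) → Maybe (Fin n)

  private
    extend : ∀ {n} → Maybe (Fin n) → List (Fin n) → List (Fin n)
    extend nothing  qs = qs
    extend (just i) qs = i ∷ qs

  -- the elements queried (most recent first) after j rounds, on true values w
  queries : Algorithm → ∀ {n} → Str n → (Fin n → Interval) → (Fin n → ℚ) → (Fin n → ℚ) →
            ℕ → List (Fin n)
  queries A s I p w zero    = []
  queries A s I p w (suc j) =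
    extend (A s I p (map (λ i → i , w i) qs)) qs
    where qs = queries A s I p w j

  -- |ALG| ≤ ρ · opt on the instance (s, I, p, w): the algorithm stops (its query set
  -- becomes feasible) after at most ρ · opt queries.
  WithinFactor : Algorithm → ℚ → ∀ {n} → Str n → (Fin n → Interval) → (Fin n → ℚ) →
                 (Fin n → ℚ) → Set
  WithinFactor A ρ s I p w =
    ∀ k → IsOpt s I w k →
      ∃ λ j → Feasible s I w (_∈ₗ queries A s I p w j) ×
              (⟦ length (queries A s I p w j) ⟧ ℚ.≤ ρ * ⟦ k ⟧)

  CompetitiveWhen : (∀ {n} → (Fin n → ℚ) → (Fin n → ℚ) → Set) → Algorithm → ℚ → Set
  CompetitiveWhen Cond A ρ =
    ∀ {n} (s : Str n) → WellPosed s →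
    (I : Fin n → Interval) (p : Fin n → ℚ) → (∀ i → p i ∈I I i) →
    (w : Fin n → ℚ) → (∀ i → w i ∈I I i) → Cond p w →
    WithinFactor A ρ s I p w

  Robust : Algorithm → ℚ → Set
  Robust = CompetitiveWhen (λ _ _ → ⊤)

  Consistent : Algorithm → ℚ → Set
  Consistent = CompetitiveWhen (λ p w → ∀ i → p i ≡ w i)

MinSingle : Problem
MinSingle = record
  { Str       = Subset
  ; WellPosed = Nonempty
  ; Ans       = λ {n} _ → Fin n
  ; Correct   = λ S e w → (e ∈ₛ S) × (∀ f → f ∈ₛ S → w e ℚ.≤ w f)
  }

-- Sorting problem: a family of m sets S₀ … S_{m-1} ⊆ Fin n; the answer gives,
-- for each set, a list of its elements (each exactly once) in non-decreasing
-- order of value.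

Sorting : Problem
Sorting = record
  { Str       = λ n → Σ ℕ λ m → Fin m → Subset n
  ; WellPosed = λ _ → ⊤
  ; Ans       = λ {n} s → Fin (proj₁ s) → List (Fin n)
  ; Correct   = λ s a w → ∀ t →
      Unique (a t) × (∀ i → (i ∈ₗ a t) ⇔ (i ∈ₛ proj₂ s t)) ×
      Linked (λ i j → w i ℚ.≤ w j) (a t)
  }

-- MST problem: a multigraph with vertex set Fin m and edge set Fin n,
-- each edge e having endpoints ends e.

record Graph (n : ℕ) : Set where
  field
    m    : ℕ
    ends : Fin n → Fin m × Fin m

module _ {n : ℕ} (G : Graph n) where
  open Graph G

  Joins : Fin n → Fin m → Fin m → Set
  Joins e u v = (ends e ≡ (u , v)) ⊎ (ends e ≡ (v , u))

  data Walk (T : Fin n → Set) : Fin m → Fin m → List (Fin n) → Set where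
    nil  : ∀ {u} → Walk T u u []
    step : ∀ {u v x e es} → T e → Joins e u v → Walk T v x es → Walk T u x (e ∷ es)

  Connected : (Fin n → Set) → Set
  Connected T = ∀ u v → ∃ λ es → Walk T u v es

  Acyclic : (Fin n → Set) → Set
  Acyclic T = ∀ u e es → Walk T u u (e ∷ es) → ¬ Unique (e ∷ es)

  IsSpanningTree : Subset n → Set
  IsSpanningTree T = Connected (_∈ₛ T) × Acyclic (_∈ₛ T)

  weight : (Fin n → ℚ) → Subset n → ℚ
  weight w T = foldr (λ e acc → (if lookup T e then w e else 0ℚ) ℚ.+ acc) 0ℚ (allFin n)

  IsMST : (Fin n → ℚ) → Subset n → Set
  IsMST w T = IsSpanningTree T ×
              ((T' : Subset n) → IsSpanningTree T' → weight w T ℚ.≤ weight w T')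

MST : Problem
MST = record
  { Str       = Graph
  ; WellPosed = λ G → Connected G (λ _ → ⊤)
  ; Ans       = λ {n} _ → Subset n
  ; Correct   = λ G T w → IsMST G w T
  }

LowerBounds : Problem → Set
LowerBounds P =
  ((b : ℕ) (α : ℚ) → α ℚ.< 1ℚ ℚ.+ inv2+ b →
     (A : Algorithm P) → Robust P A ⟦ 2 ℕ.+ b ⟧ → ¬ Consistent P A α) ×
  ((α : ℚ) (h : 1ℚ ℚ.< α) (β : ℚ) → β ℚ.< (invMinus1 α h ⊔ ⟦ 2 ⟧) →
     (A : Algorithm P) → Consistent P A α → ¬ Robust P A β)

module Submission where

-- An adversary on m + 1 elements: element 0 lies in (0,2), the others in (1,3), and the
-- predictions are 3/2 for element 0 and 5/2 for the others.  If the predictions are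
-- correct, every other element must be queried, since each could hide a value below 3/2,
-- so opt = m.  If instead element 0 has value 1/2 and element e has value 3/2, querying
-- element 0 alone suffices, so opt = 1.  An algorithm that stops after at most m queries
-- on the predicted instance has queried all elements but 0; let e be its last query.  On
-- the instance with e at 3/2 it sees the same values up to that point, so it also queries
-- all elements but 0, and must still query 0: it uses m + 1 queries against opt = 1.
-- Hence no algorithm is α-consistent and β-robust with α m < m + 1 and β < m + 1.  Taking
-- m = β gives α ≥ 1 + 1/β; taking m = ⌊β⌋ gives β ≥ 1/(α - 1), and m = 1 (with robustness
-- used on both instances) gives β ≥ 2.  The three problems enter only through the fact
-- that their answers distinguish which element is the minimum.

open import Defs
open import Data.Bool using (true; false; if_then_else_)
open import Data.Empty using (⊥)
open import Data.Fin using (Fin; zero; suc; _≟_)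
import Data.Fin.Properties as Finₚ
open import Data.Fin.Subset using (Subset; ⁅_⁆; outside; inside; ∣_∣)
  renaming (_∈_ to _∈ₛ_; _⊆_ to _⊆ₛ_; ⊤ to everything)
open import Data.Fin.Subset.Properties
  using (∈⊤; ∣⊤∣≡n; ∣⁅x⁆∣≡1; p⊆q⇒∣p∣≤∣q∣; x∈⁅x⁆; x∈⁅y⁆⇒x≡y; x≢y⇒x∉⁅y⁆)
  renaming (_∈?_ to _∈ₛ?_)
open import Data.Integer as ℤ using (+_; -[1+_])
import Data.Integer.Properties as ℤₚ
open import Data.List using (List; []; _∷_; length; lookup; map; tabulate; foldr; allFin)
open import Data.List.Membership.Propositional using (_∈_; _∉_)
open import Data.List.Membership.Propositional.Properties using (∈-allFin)
open import Data.List.Properties using (map-cong-local; ∷-injectiveʳ)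
open import Data.List.Relation.Binary.Subset.Propositional using (_⊆_)
open import Data.List.Relation.Unary.All as All using (All)
open import Data.List.Relation.Unary.All.Properties using (tabulate⁺)
open import Data.List.Relation.Unary.AllPairs as AllPairs using (AllPairs)
open import Data.List.Relation.Unary.Any as Any using (here; there)
open import Data.List.Relation.Unary.Any.Properties using (lookup-index)
open import Data.List.Relation.Unary.Linked as Linked using (Linked)
open import Data.List.Relation.Unary.Linked.Properties using (Linked⇒AllPairs)
open import Data.Maybe using (Maybe; nothing; just)
open import Data.Nat as ℕ using (ℕ; zero; suc; s≤s; _≤′_; ≤′-refl; ≤′-step)
import Data.Nat.DivMod as ℕ
open import Data.Nat.Coprimality using (1-coprimeTo) renaming (sym to coprime-sym)
import Data.Nat.Properties as ℕₚ
open import Data.Product using (∃; _×_; _,_; proj₁; proj₂)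
open import Data.Rational as ℚ using (ℚ; mkℚ; 0ℚ; 1ℚ; _<?_)
import Data.Rational.Properties as ℚₚ
open import Data.Rational.Solver using (module +-*-Solver)
open import Data.Sum using (_⊎_; inj₁; inj₂)
open import Data.Unit using (tt)
open import Data.Vec using (_∷_)
import Data.Vec as Vec
import Data.Vec.Properties as Vecₚ
open import Data.Vec.Functional using (updateAt)
open import Data.Vec.Functional.Properties using (updateAt-updates; updateAt-minimal)
open import Function using (_∘_; const; case_of_)
open import Function.Bundles using (mk⇔; Equivalence)
open import Function.Definitions using (Injective)
open import Relation.Binary.PropositionalEquality
open import Relation.Nullary using (¬_; yes; no; contradiction)
open import Relation.Nullary.Decidable using (True; toWitness; decidable-stable)

⟦⟧≡mkℚ : ∀ k → ⟦ k ⟧ ≡ mkℚ (+ k) 0 (coprime-sym (1-coprimeTo k))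
⟦⟧≡mkℚ k = ℚₚ.normalize-coprime (coprime-sym (1-coprimeTo k))

⟦suc⟧≡1+⟦⟧ : ∀ k → ⟦ suc k ⟧ ≡ 1ℚ ℚ.+ ⟦ k ⟧
⟦suc⟧≡1+⟦⟧ k rewrite ⟦⟧≡mkℚ k = cong (λ z → (+ 1 ℤ.+ z) ℚ./ 1) (sym (ℤₚ.*-identityʳ (+ k)))

⟦⟧-cancel-< : ∀ {a b} → ⟦ a ⟧ ℚ.< ⟦ b ⟧ → a ℕ.< b
⟦⟧-cancel-< {a} {b} ⟦a⟧<⟦b⟧ rewrite ⟦⟧≡mkℚ a | ⟦⟧≡mkℚ b with ⟦a⟧<⟦b⟧
... | ℚ.*<* a*1<b*1 rewrite ℤₚ.*-identityʳ (+ a) | ℤₚ.*-identityʳ (+ b) = ℤₚ.drop‿+<+ a*1<b*1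

⟦⟧<⟦suc⟧ : ∀ k → ⟦ k ⟧ ℚ.< ⟦ suc k ⟧
⟦⟧<⟦suc⟧ k = subst₂ ℚ._<_ (ℚₚ.+-identityˡ ⟦ k ⟧) (sym (⟦suc⟧≡1+⟦⟧ k))
  (ℚₚ.+-monoˡ-< ⟦ k ⟧ (ℚₚ.positive⁻¹ 1ℚ))

-- inv2+ b is the normalised form of 1/ ⟦ 2 + b ⟧, so the field inverse law applies.
inv2+-inverseˡ : ∀ b → inv2+ b ℚ.* ⟦ 2 ℕ.+ b ⟧ ≡ 1ℚ
inv2+-inverseˡ b rewrite ⟦⟧≡mkℚ (2 ℕ.+ b) | ℚₚ.normalize-coprime (1-coprimeTo (2 ℕ.+ b)) =
  ℚₚ.*-inverseˡ (mkℚ (+ (2 ℕ.+ b)) 0 (coprime-sym (1-coprimeTo (2 ℕ.+ b))))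

nonNegative⇒floor : ∀ β → 0ℚ ℚ.≤ β → ∃ λ M → ⟦ M ⟧ ℚ.≤ β × β ℚ.< ⟦ suc M ⟧
nonNegative⇒floor (mkℚ -[1+ _ ] _ _) (ℚ.*≤* ())
nonNegative⇒floor (mkℚ (+ a) d-1 _) _ = M , lower , upper
  where
  d = suc d-1
  M = a ℕ./ d
  lower : ⟦ M ⟧ ℚ.≤ mkℚ (+ a) d-1 _
  lower rewrite ⟦⟧≡mkℚ M = ℚ.*≤* (subst₂ ℤ._≤_ (ℤₚ.pos-* M d) (sym (ℤₚ.*-identityʳ (+ a)))
    (ℤ.+≤+ (ℕ.m/n*n≤m a d)))
  a<[1+M]*d : a ℕ.< suc M ℕ.* d
  a<[1+M]*d = subst (ℕ._< d ℕ.+ M ℕ.* d) (sym (ℕ.m≡m%n+[m/n]*n a d))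
    (ℕₚ.+-monoˡ-< (M ℕ.* d) (ℕ.m%n<n a d))
  upper : mkℚ (+ a) d-1 _ ℚ.< ⟦ suc M ⟧
  upper rewrite ⟦⟧≡mkℚ (suc M) = ℚ.*<* (subst₂ ℤ._<_ (sym (ℤₚ.*-identityʳ (+ a))) (ℤₚ.pos-* (suc M) d)
    (ℤ.+<+ a<[1+M]*d))

<-⊔-cases : ∀ {x y z} → x ℚ.< y ℚ.⊔ z → x ℚ.< y ⊎ x ℚ.< z
<-⊔-cases {x} {y} {z} x<y⊔z with ℚₚ.⊔-sel y z
... | inj₁ y⊔z≡y = inj₁ (subst (x ℚ.<_) y⊔z≡y x<y⊔z)
... | inj₂ y⊔z≡z = inj₂ (subst (x ℚ.<_) y⊔z≡z x<y⊔z)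

<1+inv2+⇒*⟦⟧<⟦suc⟧ : ∀ b {α} → α ℚ.< 1ℚ ℚ.+ inv2+ b → α ℚ.* ⟦ 2 ℕ.+ b ⟧ ℚ.< ⟦ 3 ℕ.+ b ⟧
<1+inv2+⇒*⟦⟧<⟦suc⟧ b {α} α<1+1/β = begin-strict
  α ℚ.* β                    <⟨ ℚₚ.*-monoˡ-<-pos β α<1+1/β ⟩
  (1ℚ ℚ.+ inv2+ b) ℚ.* β     ≡⟨ ℚₚ.*-distribʳ-+ β 1ℚ (inv2+ b) ⟩
  1ℚ ℚ.* β ℚ.+ inv2+ b ℚ.* β ≡⟨ cong₂ ℚ._+_ (ℚₚ.*-identityˡ β) (inv2+-inverseˡ b) ⟩
  β ℚ.+ 1ℚ                   ≡⟨ ℚₚ.+-comm β 1ℚ ⟩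
  1ℚ ℚ.+ β                   ≡⟨ sym (⟦suc⟧≡1+⟦⟧ (2 ℕ.+ b)) ⟩
  ⟦ 3 ℕ.+ b ⟧                ∎
  where
  open ℚₚ.≤-Reasoning
  β = ⟦ 2 ℕ.+ b ⟧
  instance
    β-positive : ℚ.Positive β
    β-positive = ℚₚ.normalize-pos (2 ℕ.+ b) 1

<invMinus1⇒*⟦⟧<⟦suc⟧ : ∀ α (1<α : 1ℚ ℚ.< α) {β} M → ⟦ M ⟧ ℚ.≤ β → β ℚ.< invMinus1 α 1<α →
                                α ℚ.* ⟦ M ⟧ ℚ.< ⟦ suc M ⟧
<invMinus1⇒*⟦⟧<⟦suc⟧ α 1<α {β} M M≤β β<1/[α-1] = begin-strict
  α ℚ.* ⟦ M ⟧                  ≡⟨ α*x≡x*[α-1]+x α ⟦ M ⟧ ⟩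
  ⟦ M ⟧ ℚ.* δ ℚ.+ ⟦ M ⟧         ≤⟨ ℚₚ.+-monoˡ-≤ ⟦ M ⟧ (ℚₚ.*-monoʳ-≤-nonNeg δ M≤β) ⟩
  β ℚ.* δ ℚ.+ ⟦ M ⟧             <⟨ ℚₚ.+-monoˡ-< ⟦ M ⟧ β*δ<1 ⟩
  1ℚ ℚ.+ ⟦ M ⟧                  ≡⟨ sym (⟦suc⟧≡1+⟦⟧ M) ⟩
  ⟦ suc M ⟧                     ∎
  where
  open ℚₚ.≤-Reasoning
  δ = α ℚ.- 1ℚ
  instance
    δ-positive : ℚ.Positive δ
    δ-positive = ℚ.positive (1<⇒0<-1 α 1<α)
    δ-nonNegative : ℚ.NonNegative δ
    δ-nonNegative = ℚₚ.pos⇒nonNeg δ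
    δ-nonZero : ℚ.NonZero δ
    δ-nonZero = ℚₚ.pos⇒nonZero δ
  α*x≡x*[α-1]+x : ∀ α x → α ℚ.* x ≡ x ℚ.* (α ℚ.- 1ℚ) ℚ.+ x
  α*x≡x*[α-1]+x = solve 2 (λ α x → α :* x := x :* (α :- con 1ℚ) :+ x) refl
    where open +-*-Solver
  β*δ<1 : β ℚ.* δ ℚ.< 1ℚ
  β*δ<1 = subst (β ℚ.* δ ℚ.<_) (ℚₚ.*-inverseˡ δ) (ℚₚ.*-monoˡ-<-pos δ β<1/[α-1])

<⇒≱ : ∀ {x y : ℚ} → x ℚ.< y → ¬ (y ℚ.≤ x)
<⇒≱ x<y y≤x = ℚₚ.<-irrefl refl (ℚₚ.<-≤-trans x<y y≤x)

<-by-decision : {x y : ℚ} {_ : True (x <? y)} → x ℚ.< y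
<-by-decision {_} {_} {x<y} = toWitness x<y

injection-into⇒≤length : ∀ {a} {A : Set a} {k} (f : Fin k → A) → Injective _≡_ _≡_ f →
                         (xs : List A) → (∀ i → f i ∈ xs) → k ℕ.≤ length xs
injection-into⇒≤length {k = k} f f-injective xs f∈xs with k ℕ.≤? length xs
... | yes k≤length = k≤length
... | no k≰length with Finₚ.pigeonhole (ℕₚ.≰⇒> k≰length) (Any.index ∘ f∈xs)
...   | i , j , i<j , same-position = contradiction (f-injective fi≡fj) (Finₚ.<⇒≢ i<j)
  where
  fi≡fj = trans (lookup-index (f∈xs i))
            (trans (cong (lookup xs) same-position) (sym (lookup-index (f∈xs j))))

covers⇒≤length : ∀ {n} (xs : List (Fin n)) → (∀ i → i ∈ xs) → n ℕ.≤ length xs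
covers⇒≤length xs = injection-into⇒≤length (λ i → i) (λ eq → eq) xs

covers-suc⇒≤length : ∀ {n} (xs : List (Fin (suc n))) → (∀ i → suc i ∈ xs) → n ℕ.≤ length xs
covers-suc⇒≤length = injection-into⇒≤length suc Finₚ.suc-injective

AllPairs-∈⇒related : ∀ {A : Set} {R : A → A → Set} {xs x y} → AllPairs R xs → x ∈ xs → y ∈ xs → x ≢ y →
                     R x y ⊎ R y x
AllPairs-∈⇒related (_ AllPairs.∷ _)   (here refl) (here refl) x≢y = contradiction refl x≢y
AllPairs-∈⇒related (Rx AllPairs.∷ _)  (here refl) (there y∈)  _   = inj₁ (All.lookup Rx y∈)
AllPairs-∈⇒related (Rx AllPairs.∷ _)  (there x∈)  (here refl) _   = inj₂ (All.lookup Rx x∈)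
AllPairs-∈⇒related (_ AllPairs.∷ Rxs) (there x∈)  (there y∈)  x≢y = AllPairs-∈⇒related Rxs x∈ y∈ x≢y

sumOver : ∀ {A : Set} → (A → ℚ) → List A → ℚ
sumOver g = foldr (λ e acc → g e ℚ.+ acc) 0ℚ

sumOver-zero : ∀ {A : Set} {g : A → ℚ} {xs} → All (λ e → g e ≡ 0ℚ) xs → sumOver g xs ≡ 0ℚ
sumOver-zero All.[]           = refl
sumOver-zero (g≡0 All.∷ rest) = trans (cong₂ ℚ._+_ g≡0 (sumOver-zero rest)) (ℚₚ.+-identityʳ 0ℚ)

sumOver-tabulate-single : ∀ {A : Set} {g : A → ℚ} {n} (f : Fin n → A) x →
                          (∀ i → i ≢ x → g (f i) ≡ 0ℚ) → sumOver g (tabulate f) ≡ g (f x)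
sumOver-tabulate-single {g = g} f zero vanish =
  trans (cong (g (f zero) ℚ.+_) (sumOver-zero {g = g} (tabulate⁺ λ i → vanish (suc i) λ ())))
        (ℚₚ.+-identityʳ (g (f zero)))
sumOver-tabulate-single {g = g} f (suc x) vanish =
  trans (cong₂ ℚ._+_ (vanish zero λ ())
                     (sumOver-tabulate-single {g = g} (f ∘ suc) x
                        λ i i≢x → vanish (suc i) (i≢x ∘ Finₚ.suc-injective)))
        (ℚₚ.+-identityˡ _)

sumOver-nonNegative : ∀ {A : Set} {g : A → ℚ} → (∀ e → 0ℚ ℚ.≤ g e) → ∀ xs → 0ℚ ℚ.≤ sumOver g xs
sumOver-nonNegative nonNeg []       = ℚₚ.≤-refl
sumOver-nonNegative nonNeg (x ∷ xs) = ℚₚ.+-mono-≤ (nonNeg x) (sumOver-nonNegative nonNeg xs)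

sumOver-≥-member : ∀ {A : Set} {g : A → ℚ} {xs x} → (∀ e → 0ℚ ℚ.≤ g e) → x ∈ xs → g x ℚ.≤ sumOver g xs
sumOver-≥-member {g = g} {y ∷ xs} nonNeg (here refl) =
  subst (ℚ._≤ sumOver g (y ∷ xs)) (ℚₚ.+-identityʳ (g y))
    (ℚₚ.+-monoʳ-≤ (g y) (sumOver-nonNegative nonNeg xs))
sumOver-≥-member {g = g} {y ∷ xs} nonNeg (there x∈) =
  ℚₚ.≤-trans (sumOver-≥-member nonNeg x∈)
    (subst (ℚ._≤ sumOver g (y ∷ xs)) (ℚₚ.+-identityˡ _) (ℚₚ.+-monoˡ-≤ (sumOver g xs) (nonNeg y)))

updateAt∈ : ∀ {n} (I : Fin n → Interval) {w : Fin n → ℚ} {x v} →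
            (∀ i → w i ∈I I i) → v ∈I I x → ∀ i → updateAt w x (const v) i ∈I I i
updateAt∈ I {w} {x} w∈ v∈ i with i ≟ x
... | yes refl = subst (_∈I I i) (sym (updateAt-updates i w)) v∈
... | no i≢x = subst (_∈I I i) (sym (updateAt-minimal i x w i≢x)) (w∈ i)

module _ (P : Problem) where
  open Problem P

  feasible⇒same-answer-after-update :
    ∀ {n} {s : Str n} {I w Q x v} → Feasible P s I w Q → (∀ i → w i ∈I I i) → ¬ Q x → v ∈I I x →
    ∃ λ a → Correct s a w × Correct s a (updateAt w x (const v))
  feasible⇒same-answer-after-update {w = w} {Q} {x} {v} (a , correct) w∈ x∉Q v∈ =
    a , correct w w∈ (λ _ _ → refl) ,
    correct (updateAt w x (const v)) (updateAt∈ _ w∈ v∈)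
      (λ i i∈Q → updateAt-minimal i x w (λ { refl → x∉Q i∈Q }))

  robust⇒consistent : ∀ {A : Algorithm P} {ρ} → Robust P A ρ → Consistent P A ρ
  robust⇒consistent robust s well-posed I p p∈ w w∈ _ = robust s well-posed I p p∈ w w∈ tt

  module Run (A : Algorithm P) {n} (s : Str n) (I : Fin n → Interval) (p : Fin n → ℚ) where

    run : (Fin n → ℚ) → ℕ → List (Fin n)
    run = queries P A s I p

    history : (Fin n → ℚ) → List (Fin n) → List (Fin n × ℚ)
    history w = map (λ i → i , w i)

    push : Maybe (Fin n) → List (Fin n) → List (Fin n)
    push nothing  qs = qs
    push (just i) qs = i ∷ qs

    StopsWithin : (Fin n → ℚ) → ℕ → Set
    StopsWithin w N = ∃ λ j → Feasible P s I w (_∈ run w j) × length (run w j) ℕ.≤ N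

    run-suc : ∀ w j → run w (suc j) ≡ push (A s I p (history w (run w j))) (run w j)
    run-suc w j with A s I p (history w (run w j))
    ... | nothing = refl
    ... | just _  = refl

    run-⊆-suc : ∀ w j → run w j ⊆ run w (suc j)
    run-⊆-suc w j x∈ rewrite run-suc w j with A s I p (history w (run w j))
    ... | nothing = x∈
    ... | just _  = there x∈

    run-mono : ∀ w {j j′} → j ℕ.≤ j′ → run w j ⊆ run w j′
    run-mono w = go ∘ ℕₚ.≤⇒≤′
      where
      go : ∀ {j j′} → j ≤′ j′ → run w j ⊆ run w j′
      go ≤′-refl       = λ x∈ → x∈
      go (≤′-step {j′} j≤j′) = run-⊆-suc w j′ ∘ go j≤j′

    run-last : ∀ w j {x xs} → run w j ≡ x ∷ xs → ∃ λ r → run w r ≡ xs × run w (suc r) ≡ x ∷ xs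
    run-last w zero    ()
    run-last w (suc j) {x} {xs} eq = from-push _ (trans (sym (run-suc w j)) eq)
      where
      from-push : ∀ next → push next (run w j) ≡ x ∷ xs →
                  ∃ λ r → run w r ≡ xs × run w (suc r) ≡ x ∷ xs
      from-push nothing  eq′ = run-last w j eq′
      from-push (just _) eq′ = j , ∷-injectiveʳ eq′ , eq

    run-agree : ∀ w w′ r → (∀ {i} → i ∈ run w r → w′ i ≡ w i) → run w′ (suc r) ≡ run w (suc r)
    run-agree w w′ zero    _     = refl
    run-agree w w′ (suc r) agree = begin
      run w′ (suc (suc r))                ≡⟨ run-suc w′ (suc r) ⟩
      push (A s I p (history w′ qs′)) qs′ ≡⟨ cong (λ qs → push (A s I p (history w′ qs)) qs) previous ⟩
      push (A s I p (history w′ qs)) qs   ≡⟨ cong (λ h → push (A s I p h) qs) same-history ⟩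
      push (A s I p (history w qs)) qs    ≡⟨ sym (run-suc w (suc r)) ⟩
      run w (suc (suc r))                 ∎
      where
      open ≡-Reasoning
      qs  = run w (suc r)
      qs′ = run w′ (suc r)
      previous : qs′ ≡ qs
      previous = run-agree w w′ r (agree ∘ run-⊆-suc w r)
      same-history : history w′ qs ≡ history w qs
      same-history = map-cong-local (All.tabulate (cong (_ ,_) ∘ agree))

    within-factor⇒stops-within : ∀ {ρ w k N} → WithinFactor P A ρ s I p w → IsOpt P s I w k →
                                 ρ ℚ.* ⟦ k ⟧ ℚ.< ⟦ suc N ⟧ → StopsWithin w N
    within-factor⇒stops-within within opt ρk<N+1 with within _ opt
    ... | j , feasible , short = j , feasible ,
          ℕₚ.≤-pred (⟦⟧-cancel-< (ℚₚ.≤-<-trans short ρk<N+1))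

record Adversary (P : Problem) (m : ℕ) : Set₁ where
  open Problem P
  field
    structure                 : Str (suc m)
    well-posed                : WellPosed structure
    interval                  : Fin (suc m) → Interval
    predicted                 : Fin (suc m) → ℚ
    predicted∈                : ∀ i → predicted i ∈I interval i
    alternative               : Fin m → Fin (suc m) → ℚ
    alternative∈              : ∀ e i → alternative e i ∈I interval i
    alternative-agrees        : ∀ e i → i ≢ zero → i ≢ suc e → alternative e i ≡ predicted i
    predicted-feasible⇒suc    : ∀ {Q} j → Feasible P structure interval predicted Q → ¬ ¬ Q (suc j)
    alternative-feasible⇒zero : ∀ e {Q} → Feasible P structure interval (alternative e) Q → ¬ ¬ Q zero
    predicted-feasible        : Feasible P structure interval predicted (_∈ₛ (outside ∷ everything))
    alternative-feasible      : ∀ e → Feasible P structure interval (alternative e) (_∈ₛ ⁅ zero ⁆)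

module _ {P : Problem} {m} (adv : Adversary P m) where
  open Adversary adv

  predicted-opt : IsOpt P structure interval predicted m
  predicted-opt = (outside ∷ everything , ∣⊤∣≡n m , predicted-feasible) ,
    λ Q feasible → subst (ℕ._≤ ∣ Q ∣) (∣⊤∣≡n m) (p⊆q⇒∣p∣≤∣q∣ (others⊆ feasible))
    where
    others⊆ : ∀ {Q} → Feasible P structure interval predicted (_∈ₛ Q) → (outside ∷ everything) ⊆ₛ Q
    others⊆ {Q} feasible {suc j} _ = decidable-stable (suc j ∈ₛ? Q) (predicted-feasible⇒suc j feasible)

  alternative-opt : ∀ e → IsOpt P structure interval (alternative e) 1
  alternative-opt e = (⁅ zero ⁆ , ∣⁅x⁆∣≡1 (zero {m}) , alternative-feasible e) ,
    λ Q feasible → subst (ℕ._≤ ∣ Q ∣) (∣⁅x⁆∣≡1 (zero {m})) (p⊆q⇒∣p∣≤∣q∣ (zero⊆ feasible))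
    where
    zero⊆ : ∀ {Q} → Feasible P structure interval (alternative e) (_∈ₛ Q) → ⁅ zero ⁆ ⊆ₛ Q
    zero⊆ {Q} feasible {i} i∈ rewrite x∈⁅y⁆⇒x≡y zero i∈ =
      decidable-stable (zero ∈ₛ? Q) (alternative-feasible⇒zero e feasible)

module _ {P : Problem} {m} (adv : Adversary P (suc m)) (A : Algorithm P) where
  open Adversary adv
  open Run P A structure interval predicted

  predicted-feasible⇒queries-suc : ∀ {j} → Feasible P structure interval predicted (_∈ run predicted j) →
                                   ∀ i → suc i ∈ run predicted j
  predicted-feasible⇒queries-suc {j} feasible i =
    decidable-stable (Any.any? (suc i ≟_) (run predicted j)) (predicted-feasible⇒suc i feasible)

  alternative-feasible⇒queries-zero : ∀ e {j} →
                                      Feasible P structure interval (alternative e) (_∈ run (alternative e) j) →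
                                      zero ∈ run (alternative e) j
  alternative-feasible⇒queries-zero e {j} feasible =
    decidable-stable (Any.any? (zero ≟_) (run (alternative e) j)) (alternative-feasible⇒zero e feasible)

  alternative-exceeds : ∀ e r → zero ∉ run (alternative e) r → (∀ i → suc i ∈ run (alternative e) r) →
                        ¬ StopsWithin (alternative e) (suc m)
  alternative-exceeds e r zero∉ others∈ (j , feasible , short)
    with ℕₚ.≤-total j r | alternative-feasible⇒queries-zero e {j} feasible
  ... | inj₁ j≤r | zero∈ = zero∉ (run-mono (alternative e) j≤r zero∈)
  ... | inj₂ r≤j | zero∈ = ℕₚ.≤⇒≯ short (covers⇒≤length (run (alternative e) j)
                             λ { zero → zero∈ ; (suc i) → run-mono (alternative e) r≤j (others∈ i) })

  -- If suc e is the last query of a run on the predictions, then the run on w e makes the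
  -- same queries, since the two value assignments agree on all earlier queries.
  last-query-defeats : ∀ j {qs} → run predicted j ≡ qs → (∀ i → suc i ∈ qs) → zero ∉ qs →
                       length qs ℕ.≤ suc m → ¬ (∀ e → StopsWithin (alternative e) (suc m))
  last-query-defeats j {[]}         _  others∈ _     _     _ = case others∈ zero of λ ()
  last-query-defeats j {zero ∷ _}   _  _       zero∉ _     _ = zero∉ (here refl)
  last-query-defeats j {suc e ∷ xs} eq others∈ zero∉ short alternative-stops with run-last predicted j eq
  ... | r , run-r , run-r+1 =
    alternative-exceeds e (suc r)
      (zero∉ ∘ subst (zero ∈_) same-run) (subst (λ qs → ∀ i → suc i ∈ qs) (sym same-run) others∈)
      (alternative-stops e)
    where
    e∉xs : suc e ∉ xs
    e∉xs e∈xs = ℕₚ.≤⇒≯ short (s≤s (covers-suc⇒≤length xs others∈xs))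
      where
      others∈xs : ∀ i → suc i ∈ xs
      others∈xs i with i ≟ e | others∈ i
      ... | yes refl | _           = e∈xs
      ... | no i≢e   | here refl   = contradiction refl i≢e
      ... | no _     | there i∈xs  = i∈xs
    agree : ∀ {i} → i ∈ run predicted r → alternative e i ≡ predicted i
    agree i∈ = alternative-agrees e _
      (λ { refl → zero∉ (there (subst (zero ∈_) run-r i∈)) })
      (λ { refl → e∉xs (subst (suc e ∈_) run-r i∈) })
    same-run : run (alternative e) (suc r) ≡ suc e ∷ xs
    same-run = trans (run-agree predicted (alternative e) r agree) run-r+1

  adversary-wins : StopsWithin predicted (suc m) → ¬ (∀ e → StopsWithin (alternative e) (suc m))
  adversary-wins (j , feasible , short) =
    last-query-defeats j refl others∈ zero∉ short
    where
    others∈ : ∀ i → suc i ∈ run predicted j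
    others∈ = predicted-feasible⇒queries-suc {j} feasible
    zero∉ : zero ∉ run predicted j
    zero∉ zero∈ = ℕₚ.≤⇒≯ short
      (covers⇒≤length (run predicted j) λ { zero → zero∈ ; (suc i) → others∈ i })

  adversary-lower-bound : ∀ ρ ρ′ → Consistent P A ρ → Robust P A ρ′ →
                          ρ ℚ.* ⟦ suc m ⟧ ℚ.< ⟦ 2 ℕ.+ m ⟧ → ρ′ ℚ.< ⟦ 2 ℕ.+ m ⟧ → ⊥
  adversary-lower-bound ρ ρ′ consistent robust ρ-small ρ′-small =
    adversary-wins
      (within-factor⇒stops-within {ρ = ρ} {N = suc m}
        (consistent structure well-posed interval predicted predicted∈ predicted predicted∈ (λ _ → refl))
        (predicted-opt adv) ρ-small)
      (λ e → within-factor⇒stops-within {ρ = ρ′} {N = suc m}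
        (robust structure well-posed interval predicted predicted∈ (alternative e) (alternative∈ e) tt)
        (alternative-opt adv e) (subst (ℚ._< ⟦ 2 ℕ.+ m ⟧) (sym (ℚₚ.*-identityʳ ρ′)) ρ′-small))

NonNegativeValues : ∀ {n} → (Fin n → ℚ) → Set
NonNegativeValues w = ∀ i → 0ℚ ℚ.≤ w i

IsStrictMinimum : ∀ {n} → (Fin n → ℚ) → Fin n → Set
IsStrictMinimum w x = ∀ i → i ≢ x → w x ℚ.< w i

isStrictMinimum⇒≤ : ∀ {n} {w : Fin n → ℚ} {x} → IsStrictMinimum w x → ∀ f → w x ℚ.≤ w f
isStrictMinimum⇒≤ {x = x} minimum f with f ≟ x
... | yes refl = ℚₚ.≤-refl
... | no f≢x   = ℚₚ.<⇒≤ (minimum f f≢x)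

-- Nonnegativity is only needed for MST, where a tree weighs at least as much as each edge.
record RevealsMinimum (P : Problem) : Set₁ where
  open Problem P
  field
    structure           : ∀ m → Str (suc m)
    well-posed          : ∀ m → WellPosed (structure m)
    zero-answer         : ∀ m → Ans (structure m)
    zero-answer-correct : ∀ m w → NonNegativeValues w → IsStrictMinimum w zero →
                          Correct (structure m) (zero-answer m) w
    separates-minima    : ∀ m j a w w′ → NonNegativeValues w → NonNegativeValues w′ →
                          IsStrictMinimum w zero → IsStrictMinimum w′ (suc j) →
                          Correct (structure m) a w → ¬ Correct (structure m) a w′

½ ⁵⁄₄ ³⁄₂ ⁷⁄₄ ⁵⁄₂ : ℚ
½   = + 1 ℚ./ 2
⁵⁄₄ = + 5 ℚ./ 4
³⁄₂ = + 3 ℚ./ 2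
⁷⁄₄ = + 7 ℚ./ 4
⁵⁄₂ = + 5 ℚ./ 2

gadgetInterval : ∀ {m} → Fin (suc m) → Interval
gadgetInterval zero    = open⟨ 0ℚ , ⟦ 2 ⟧ ⟩ <-by-decision
gadgetInterval (suc _) = open⟨ 1ℚ , ⟦ 3 ⟧ ⟩ <-by-decision

gadgetPrediction : ∀ {m} → Fin (suc m) → ℚ
gadgetPrediction zero    = ³⁄₂
gadgetPrediction (suc _) = ⁵⁄₂

gadgetAlternative : ∀ {m} → Fin m → Fin (suc m) → ℚ
gadgetAlternative e zero    = ½
gadgetAlternative e (suc j) with j ≟ e
... | yes _ = ³⁄₂
... | no _  = ⁵⁄₂

gadgetPrediction∈ : ∀ {m} (i : Fin (suc m)) → gadgetPrediction i ∈I gadgetInterval i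
gadgetPrediction∈ zero    = <-by-decision , <-by-decision
gadgetPrediction∈ (suc _) = <-by-decision , <-by-decision

gadgetAlternative∈ : ∀ {m} (e : Fin m) i → gadgetAlternative e i ∈I gadgetInterval i
gadgetAlternative∈ e zero = <-by-decision , <-by-decision
gadgetAlternative∈ e (suc j) with j ≟ e
... | yes _ = <-by-decision , <-by-decision
... | no _  = <-by-decision , <-by-decision

gadgetAlternative-agrees : ∀ {m} (e : Fin m) i → i ≢ zero → i ≢ suc e →
                           gadgetAlternative e i ≡ gadgetPrediction i
gadgetAlternative-agrees e zero    i≢0 _ = contradiction refl i≢0
gadgetAlternative-agrees e (suc j) _ i≢e with j ≟ e
... | yes refl = contradiction refl i≢e
... | no _     = refl

gadget-nonNegative : ∀ {m} {w : Fin (suc m) → ℚ} → (∀ i → w i ∈I gadgetInterval i) → NonNegativeValues w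
gadget-nonNegative w∈ zero    = ℚₚ.<⇒≤ (proj₁ (w∈ zero))
gadget-nonNegative w∈ (suc j) = ℚₚ.<⇒≤ (ℚₚ.<-trans <-by-decision (proj₁ (w∈ (suc j))))

updateAt-isStrictMinimum : ∀ {n} {w : Fin n → ℚ} {x v} → (∀ i → v ℚ.< w i) →
                           IsStrictMinimum (updateAt w x (const v)) x
updateAt-isStrictMinimum {w = w} {x} v<w i i≢x =
  subst₂ ℚ._<_ (sym (updateAt-updates x w)) (sym (updateAt-minimal i x w i≢x)) (v<w i)

gadgetPrediction-minimum : ∀ {m} → IsStrictMinimum (gadgetPrediction {m}) zero
gadgetPrediction-minimum zero    0≢0 = contradiction refl 0≢0
gadgetPrediction-minimum (suc _) _   = <-by-decision

gadgetAlternative-minimum : ∀ {m} (e : Fin m) → IsStrictMinimum (gadgetAlternative e) zero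
gadgetAlternative-minimum e zero    0≢0 = contradiction refl 0≢0
gadgetAlternative-minimum e (suc j) _ with j ≟ e
... | yes _ = <-by-decision
... | no _  = <-by-decision

lowered-prediction-minimum : ∀ {m} (j : Fin m) →
                             IsStrictMinimum (updateAt gadgetPrediction (suc j) (const ⁵⁄₄)) (suc j)
lowered-prediction-minimum j =
  updateAt-isStrictMinimum λ { zero → <-by-decision ; (suc _) → <-by-decision }

raised-alternative-minimum : ∀ {m} (e : Fin m) →
                             IsStrictMinimum (updateAt (gadgetAlternative e) zero (const ⁷⁄₄)) (suc e)
raised-alternative-minimum e i i≢e with e ≟ e
... | no e≢e = contradiction refl e≢e
raised-alternative-minimum e zero    _   | yes _ = <-by-decision
raised-alternative-minimum e (suc j) j≢e | yes _ with j ≟ e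
... | yes refl = contradiction refl j≢e
... | no _     = <-by-decision

module _ {P : Problem} (R : RevealsMinimum P) where
  open Problem P
  open RevealsMinimum R

  feasible⇒queries-moved-minimum :
    ∀ m {w Q} x j {v} → (∀ i → w i ∈I gadgetInterval i) → v ∈I gadgetInterval x →
    IsStrictMinimum w zero → IsStrictMinimum (updateAt w x (const v)) (suc j) →
    Feasible P (structure m) gadgetInterval w Q → ¬ ¬ Q x
  feasible⇒queries-moved-minimum m x j w∈ v∈ minimum moved-minimum feasible x∉Q
    with feasible⇒same-answer-after-update P feasible w∈ x∉Q v∈
  ... | a , correct , correct-after-move =
    separates-minima m j a _ _ (gadget-nonNegative w∈) (gadget-nonNegative (updateAt∈ _ w∈ v∈))
      minimum moved-minimum correct correct-after-move

  gadget : ∀ m → Adversary P m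
  gadget m = record
    { structure   = structure m
    ; well-posed  = well-posed m
    ; interval    = gadgetInterval
    ; predicted   = gadgetPrediction
    ; predicted∈  = gadgetPrediction∈
    ; alternative = gadgetAlternative
    ; alternative∈ = gadgetAlternative∈
    ; alternative-agrees = gadgetAlternative-agrees
    ; predicted-feasible⇒suc = λ j → feasible⇒queries-moved-minimum m (suc j) j gadgetPrediction∈
        (<-by-decision , <-by-decision) gadgetPrediction-minimum (lowered-prediction-minimum j)
    ; alternative-feasible⇒zero = λ e → feasible⇒queries-moved-minimum m zero e (gadgetAlternative∈ e)
        (<-by-decision , <-by-decision) (gadgetAlternative-minimum e) (raised-alternative-minimum e)
    ; predicted-feasible = zero-answer m , λ w w∈ agree →
        zero-answer-correct m w (gadget-nonNegative w∈) (others-large w∈ agree)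
    ; alternative-feasible = λ e → zero-answer m , λ w w∈ agree →
        zero-answer-correct m w (gadget-nonNegative w∈) (zero-small e w∈ agree)
    }
    where
    others-large : ∀ {w} → (∀ i → w i ∈I gadgetInterval i) →
                   (∀ i → i ∈ₛ (outside ∷ everything) → w i ≡ gadgetPrediction i) →
                   IsStrictMinimum w zero
    others-large w∈ agree zero    0≢0 = contradiction refl 0≢0
    others-large w∈ agree (suc j) _ rewrite agree (suc j) (Vec.there ∈⊤) =
      ℚₚ.<-trans (proj₂ (w∈ zero)) <-by-decision
    zero-small : ∀ e {w} → (∀ i → w i ∈I gadgetInterval i) →
                 (∀ i → i ∈ₛ ⁅ zero ⁆ → w i ≡ gadgetAlternative e i) → IsStrictMinimum w zero
    zero-small e w∈ agree zero    0≢0 = contradiction refl 0≢0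
    zero-small e w∈ agree (suc j) _ rewrite agree zero (x∈⁅x⁆ zero) =
      ℚₚ.<-trans <-by-decision (proj₁ (w∈ (suc j)))

  lowerBounds : LowerBounds P
  lowerBounds = robust⇒not-consistent , consistent⇒not-robust
    where
    robust⇒not-consistent : ∀ b α → α ℚ.< 1ℚ ℚ.+ inv2+ b → (A : Algorithm P) →
                            Robust P A ⟦ 2 ℕ.+ b ⟧ → ¬ Consistent P A α
    robust⇒not-consistent b α α-small A robust consistent =
      adversary-lower-bound (gadget (suc (suc b))) A α ⟦ 2 ℕ.+ b ⟧ consistent robust
        (<1+inv2+⇒*⟦⟧<⟦suc⟧ b α-small) (⟦⟧<⟦suc⟧ (2 ℕ.+ b))

    consistent⇒not-robust-beyond-2 : ∀ α (1<α : 1ℚ ℚ.< α) β → ⟦ 2 ⟧ ℚ.≤ β → β ℚ.< invMinus1 α 1<α →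
                                     (A : Algorithm P) → Consistent P A α → ¬ Robust P A β
    consistent⇒not-robust-beyond-2 α 1<α β 2≤β β<1/[α-1] A consistent robust
      with nonNegative⇒floor β (ℚₚ.≤-trans (ℚₚ.<⇒≤ (<-by-decision {0ℚ} {⟦ 2 ⟧})) 2≤β)
    ... | zero  , _   , β<1   = contradiction (⟦⟧-cancel-< {2} {1} (ℚₚ.≤-<-trans 2≤β β<1)) λ { (s≤s ()) }
    ... | suc m , M≤β , β<M+1 = adversary-lower-bound (gadget (suc m)) A α β consistent robust
          (<invMinus1⇒*⟦⟧<⟦suc⟧ α 1<α (suc m) M≤β β<1/[α-1]) β<M+1

    consistent⇒not-robust : ∀ α (1<α : 1ℚ ℚ.< α) β → β ℚ.< invMinus1 α 1<α ℚ.⊔ ⟦ 2 ⟧ →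
                            (A : Algorithm P) → Consistent P A α → ¬ Robust P A β
    consistent⇒not-robust α 1<α β β-small A consistent robust with β <? ⟦ 2 ⟧ | <-⊔-cases β-small
    ... | yes β<2 | _ =
          adversary-lower-bound (gadget 1) A β β (robust⇒consistent P {ρ = β} robust) robust
          (subst (ℚ._< ⟦ 2 ⟧) (sym (ℚₚ.*-identityʳ β)) β<2) β<2
    ... | no β≮2 | inj₂ β<2       = contradiction β<2 β≮2
    ... | no β≮2 | inj₁ β<1/[α-1] =
          consistent⇒not-robust-beyond-2 α 1<α β (ℚₚ.≮⇒≥ β≮2) β<1/[α-1] A consistent robust

minSingle-revealsMinimum : RevealsMinimum MinSingle
minSingle-revealsMinimum = record
  { structure           = λ _ → everything
  ; well-posed          = λ _ → zero , ∈⊤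
  ; zero-answer         = λ _ → zero
  ; zero-answer-correct = λ _ w _ minimum → ∈⊤ , λ f _ → isStrictMinimum⇒≤ minimum f
  ; separates-minima    = separates
  }
  where
  separates : ∀ m (j : Fin m) a w w′ → NonNegativeValues w → NonNegativeValues w′ →
              IsStrictMinimum w zero → IsStrictMinimum w′ (suc j) →
              Problem.Correct MinSingle everything a w → ¬ Problem.Correct MinSingle everything a w′
  separates m j a w w′ _ _ minimum minimum′ (_ , a-least) (_ , a-least′) with a ≟ zero
  ... | yes refl = <⇒≱ (minimum′ zero λ ()) (a-least′ (suc j) ∈⊤)
  ... | no a≢0   = <⇒≱ (minimum a a≢0) (a-least zero ∈⊤)

sorting-revealsMinimum : RevealsMinimum Sorting
sorting-revealsMinimum = record
  { structure           = λ m → m , λ t → inside ∷ ⁅ t ⁆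
  ; well-posed          = λ _ → tt
  ; zero-answer         = λ _ t → zero ∷ suc t ∷ []
  ; zero-answer-correct = λ _ w _ minimum t →
      ((λ ()) All.∷ All.[]) AllPairs.∷ (All.[] AllPairs.∷ AllPairs.[]) ,
      (λ i → mk⇔ to from) ,
      ℚₚ.<⇒≤ (minimum (suc t) λ ()) Linked.∷ Linked.[-]
  ; separates-minima    = separates
  }
  where
  to : ∀ {m} {t : Fin m} {i} → i ∈ zero ∷ suc t ∷ [] → i ∈ₛ (inside ∷ ⁅ t ⁆)
  to (here refl)         = Vec.here
  to (there (here refl)) = Vec.there (x∈⁅x⁆ _)
  from : ∀ {m} {t : Fin m} {i} → i ∈ₛ (inside ∷ ⁅ t ⁆) → i ∈ zero ∷ suc t ∷ []
  from {i = zero}  Vec.here       = here refl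
  from {i = suc _} (Vec.there i∈) = there (here (cong suc (x∈⁅y⁆⇒x≡y _ i∈)))
  separates : ∀ m (j : Fin m) a w w′ → NonNegativeValues w → NonNegativeValues w′ →
              IsStrictMinimum w zero → IsStrictMinimum w′ (suc j) →
              Problem.Correct Sorting (m , λ t → inside ∷ ⁅ t ⁆) a w →
              ¬ Problem.Correct Sorting (m , λ t → inside ∷ ⁅ t ⁆) a w′
  separates m j a w w′ _ _ minimum minimum′ correct correct′
    with correct j | correct′ j
  ... | _ , members , sorted | _ , _ , sorted′
    with AllPairs-∈⇒related (Linked⇒AllPairs ≤-trans₂ (Linked.zip (sorted , sorted′)))
           (Equivalence.from (members zero) Vec.here)
           (Equivalence.from (members (suc j)) (Vec.there (x∈⁅x⁆ j))) (λ ())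
    where
    ≤-trans₂ : ∀ {x y z} → w x ℚ.≤ w y × w′ x ℚ.≤ w′ y → w y ℚ.≤ w z × w′ y ℚ.≤ w′ z →
               w x ℚ.≤ w z × w′ x ℚ.≤ w′ z
    ≤-trans₂ (xy , xy′) (yz , yz′) = ℚₚ.≤-trans xy yz , ℚₚ.≤-trans xy′ yz′
  ... | inj₁ (_ , zero≤′suc) = <⇒≱ (minimum′ zero λ ()) zero≤′suc
  ... | inj₂ (suc≤zero , _)  = <⇒≱ (minimum (suc j) λ ()) suc≤zero

selected : ∀ {n} → Subset n → (Fin n → ℚ) → Fin n → ℚ
selected T w e = if Vec.lookup T e then w e else 0ℚ

selected-∈ : ∀ {n} {T : Subset n} {w f} → f ∈ₛ T → selected T w f ≡ w f
selected-∈ f∈T rewrite Vecₚ.[]=⇒lookup f∈T = refl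

selected-∉ : ∀ {n} {T : Subset n} {w f} → ¬ f ∈ₛ T → selected T w f ≡ 0ℚ
selected-∉ {T = T} {f = f} f∉T with Vec.lookup T f in eq
... | true  = contradiction (Vecₚ.lookup⇒[]= f T eq) f∉T
... | false = refl

selected-nonNegative : ∀ {n} (T : Subset n) {w} → NonNegativeValues w → NonNegativeValues (selected T w)
selected-nonNegative T nonNeg e with Vec.lookup T e
... | true  = nonNeg e
... | false = ℚₚ.≤-refl

weight-⁅⁆ : ∀ {n} (G : Graph n) w x → weight G w ⁅ x ⁆ ≡ w x
weight-⁅⁆ G w x =
  trans (sumOver-tabulate-single {g = selected ⁅ x ⁆ w} (λ i → i) x
           λ i i≢x → selected-∉ {w = w} (x≢y⇒x∉⁅y⁆ i≢x))
        (selected-∈ {w = w} (x∈⁅x⁆ x))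

weight-≥-member : ∀ {n} (G : Graph n) {w} T {f} → NonNegativeValues w → f ∈ₛ T → w f ℚ.≤ weight G w T
weight-≥-member G {w} T {f} nonNeg f∈T =
  subst (ℚ._≤ weight G w T) (selected-∈ {w = w} f∈T)
    (sumOver-≥-member (selected-nonNegative T nonNeg) (∈-allFin f))

-- Its spanning trees are exactly the single edges.
parallelEdges : ∀ m → Graph (suc m)
parallelEdges m = record { m = 2 ; ends = λ _ → zero , suc zero }

module _ {m : ℕ} where
  private
    G = parallelEdges m

  parallelEdges-connected : ∀ {T : Fin (suc m) → Set} {f} → T f → Connected G T
  parallelEdges-connected         T∋f zero       zero       = [] , nil
  parallelEdges-connected {f = f} T∋f zero       (suc zero) = f ∷ [] , step T∋f (inj₁ refl) nil
  parallelEdges-connected {f = f} T∋f (suc zero) zero       = f ∷ [] , step T∋f (inj₂ refl) nil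
  parallelEdges-connected         T∋f (suc zero) (suc zero) = [] , nil

  parallelEdges-edge : ∀ {T : Fin (suc m) → Set} → Connected G T → ∃ T
  parallelEdges-edge connected with connected zero (suc zero)
  ... | _ , step T∋f _ _ = _ , T∋f

  ⁅⁆-isSpanningTree : ∀ x → IsSpanningTree G ⁅ x ⁆
  ⁅⁆-isSpanningTree x = parallelEdges-connected (x∈⁅x⁆ x) , acyclic
    where
    no-loop : ∀ {e u} → ¬ Joins G e u u
    no-loop (inj₁ ())
    no-loop (inj₂ ())
    acyclic : Acyclic G (_∈ₛ ⁅ x ⁆)
    acyclic u e []       (step _ joins nil) _ = no-loop {e} {u} joins
    acyclic u e (_ ∷ _) (step e∈ _ (step e′∈ _ _)) ((e≢e′ All.∷ _) AllPairs.∷ _) =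
      e≢e′ (trans (x∈⁅y⁆⇒x≡y x e∈) (sym (x∈⁅y⁆⇒x≡y x e′∈)))

  isMST⇒weight≤ : ∀ {w T} → IsMST G w T → ∀ x → weight G w T ℚ.≤ w x
  isMST⇒weight≤ {w} {T} (_ , minimal) x =
    subst (weight G w T ℚ.≤_) (weight-⁅⁆ G w x) (minimal ⁅ x ⁆ (⁅⁆-isSpanningTree x))

mst-revealsMinimum : RevealsMinimum MST
mst-revealsMinimum = record
  { structure           = parallelEdges
  ; well-posed          = λ _ → parallelEdges-connected {f = zero} tt
  ; zero-answer         = λ _ → ⁅ zero ⁆
  ; zero-answer-correct = λ m w nonNeg minimum → ⁅⁆-isSpanningTree zero , λ T′ tree′ →
      lightest T′ w nonNeg minimum (parallelEdges-edge (proj₁ tree′))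
  ; separates-minima    = separates
  }
  where
  lightest : ∀ {m} (T′ : Subset (suc m)) w → NonNegativeValues w → IsStrictMinimum w zero →
             ∃ (_∈ₛ T′) → weight (parallelEdges m) w ⁅ zero ⁆ ℚ.≤ weight (parallelEdges m) w T′
  lightest {m} T′ w nonNeg minimum (f , f∈T′) rewrite weight-⁅⁆ (parallelEdges m) w zero =
    ℚₚ.≤-trans (isStrictMinimum⇒≤ minimum f) (weight-≥-member (parallelEdges m) T′ nonNeg f∈T′)
  separates : ∀ m (j : Fin m) T w w′ → NonNegativeValues w → NonNegativeValues w′ →
              IsStrictMinimum w zero → IsStrictMinimum w′ (suc j) →
              IsMST (parallelEdges m) w T → ¬ IsMST (parallelEdges m) w′ T
  separates m j T w w′ nonNeg nonNeg′ minimum minimum′ mst mst′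
    with parallelEdges-edge (proj₁ (proj₁ mst))
  ... | f , f∈T with f ≟ zero
  ...   | yes refl = <⇒≱ (minimum′ zero λ ())
                       (ℚₚ.≤-trans (weight-≥-member (parallelEdges m) T nonNeg′ f∈T)
                                   (isMST⇒weight≤ mst′ (suc j)))
  ...   | no f≢0   = <⇒≱ (minimum f f≢0)
                       (ℚₚ.≤-trans (weight-≥-member (parallelEdges m) T nonNeg f∈T)
                                   (isMST⇒weight≤ mst zero))

theorem1 : LowerBounds MinSingle × LowerBounds Sorting × LowerBounds MST
theorem1 = lowerBounds minSingle-revealsMinimum
         , lowerBounds sorting-revealsMinimum
         , lowerBounds mst-revealsMinimum
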